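{- For every graph $G$ and every 2-switch $\tau$ on $G$, $|\gamma(\tau(G))-\gamma(G)|\le 1$, where $\gamma$ denotes the domination number.
   Context: Graphs are finite and simple. A 2-switch on $G$ is specified by four distinct vertices $a,b,c,d$ with $ab,cd\in E(G)$ and $ac,bd\notin E(G)$; it produces $\tau(G)=G-ab-cd+ac+bd$. $\gamma(G)$ is the minimum size of a set $D\subseteq V(G)$ such that every vertex not in $D$ is adjacent to some vertex of $D$. -}

module Defs where

open import Data.Nat using (ℕ; _≤_; _+_)
open import Data.Bool using (Bool; true; false; if_then_else_; _∨_; _∧_; not)
open import Data.Fin using (Fin)
open import Data.Fin.Subset using (Subset; _∈_; _∉_; ∣_∣)
open import Data.Product using (Σ; ∃; _×_; _,_)
open import Relation.Binary.PropositionalEquality using (_≡_; _≢_)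
open import Relation.Nullary using (¬_; does)
open import Data.Fin.Properties using (_≟_)

record Graph (n : ℕ) : Set where
  field
    adj   : Fin n → Fin n → Bool
    sym   : ∀ u v → adj u v ≡ adj v u
    irrefl : ∀ v → adj v v ≡ false
open Graph public

Edge : ∀ {n} → Graph n → Fin n → Fin n → Set
Edge G u v = adj G u v ≡ true

Dominating : ∀ {n} → Graph n → Subset n → Set
Dominating {n} G D = ∀ (v : Fin n) → v ∉ D → ∃ λ u → u ∈ D × Edge G u v

IsDominationNumber : ∀ {n} → Graph n → ℕ → Set
IsDominationNumber {n} G k =
  (Σ (Subset n) λ D → Dominating G D × ∣ D ∣ ≡ k)
  × (∀ (D : Subset n) → Dominating G D → k ≤ ∣ D ∣)

samePair : ∀ {n} → Fin n → Fin n → Fin n → Fin n → Bool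
samePair x y p q =
  (does (x ≟ p) ∧ does (y ≟ q)) ∨ (does (x ≟ q) ∧ does (y ≟ p))

record TwoSwitch {n : ℕ} (G : Graph n) : Set where
  field
    a b c d : Fin n
    a≢b : a ≢ b
    a≢c : a ≢ c
    a≢d : a ≢ d
    b≢c : b ≢ c
    b≢d : b ≢ d
    c≢d : c ≢ d
    ab∈E : Edge G a b
    cd∈E : Edge G c d
    ac∉E : ¬ Edge G a c
    bd∉E : ¬ Edge G b d
open TwoSwitch public

switchAdj : ∀ {n} (G : Graph n) → TwoSwitch G → Fin n → Fin n → Bool
switchAdj G t x y =
  if samePair x y (a t) (b t) ∨ samePair x y (c t) (d t) then false
  else if samePair x y (a t) (c t) ∨ samePair x y (b t) (d t) then true
  else adj G x y

private
  open import Data.Bool.Properties using (∨-comm)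
  open import Relation.Binary.PropositionalEquality using (refl; cong; trans; sym)
  open import Relation.Nullary using (yes; no)
  open import Data.Empty using (⊥-elim)

  samePair-sym : ∀ {n} (x y p q : Fin n) → samePair x y p q ≡ samePair y x p q
  samePair-sym x y p q with x ≟ p | y ≟ q | x ≟ q | y ≟ p
  ... | yes _ | yes _ | yes _ | yes _ = refl
  ... | yes _ | yes _ | yes _ | no  _ = refl
  ... | yes _ | yes _ | no  _ | yes _ = refl
  ... | yes _ | yes _ | no  _ | no  _ = refl
  ... | yes _ | no  _ | yes _ | yes _ = refl
  ... | yes _ | no  _ | yes _ | no  _ = refl
  ... | yes _ | no  _ | no  _ | yes _ = refl
  ... | yes _ | no  _ | no  _ | no  _ = refl
  ... | no  _ | yes _ | yes _ | yes _ = refl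
  ... | no  _ | yes _ | yes _ | no  _ = refl
  ... | no  _ | yes _ | no  _ | yes _ = refl
  ... | no  _ | yes _ | no  _ | no  _ = refl
  ... | no  _ | no  _ | yes _ | yes _ = refl
  ... | no  _ | no  _ | yes _ | no  _ = refl
  ... | no  _ | no  _ | no  _ | yes _ = refl
  ... | no  _ | no  _ | no  _ | no  _ = refl

  samePair-diag : ∀ {n} (x p q : Fin n) → p ≢ q → samePair x x p q ≡ false
  samePair-diag x p q p≢q with x ≟ p | x ≟ q
  ... | yes refl | yes refl = ⊥-elim (p≢q refl)
  ... | yes _ | no _ = refl
  ... | no _ | yes _ = refl
  ... | no _ | no _ = refl

switchAdj-sym : ∀ {n} (G : Graph n) (t : TwoSwitch G) x y →
                switchAdj G t x y ≡ switchAdj G t y x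
switchAdj-sym G t x y
  rewrite samePair-sym x y (a t) (b t) | samePair-sym x y (c t) (d t)
        | samePair-sym x y (a t) (c t) | samePair-sym x y (b t) (d t)
        | Graph.sym G x y = refl

switchAdj-irrefl : ∀ {n} (G : Graph n) (t : TwoSwitch G) x →
                   switchAdj G t x x ≡ false
switchAdj-irrefl G t x
  rewrite samePair-diag x (a t) (b t) (a≢b t) | samePair-diag x (c t) (d t) (c≢d t)
        | samePair-diag x (a t) (c t) (a≢c t) | samePair-diag x (b t) (d t) (b≢d t)
        = Graph.irrefl G x

τ : ∀ {n} (G : Graph n) → TwoSwitch G → Graph n
τ G t = record
  { adj = switchAdj G t
  ; sym = switchAdj-sym G t
  ; irrefl = switchAdj-irrefl G t
  }

{-# OPTIONS --safe #-}
module Submission where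

-- A dominating set D of G dominates τ(G) except where it used one of the removed
-- edges ab, cd. Such a use is repaired by the new edges ac, bd as soon as D meets
-- {b,d} whenever it meets {a,c}, and meets {a,c} whenever it meets {b,d}; adding a
-- single vertex (a if D meets {b,d}, otherwise b) achieves both. Hence
-- γ(τ(G)) ≤ γ(G) + 1, and the same argument for the 2-switch on τ(G) that removes
-- ac, bd and restores ab, cd gives γ(G) ≤ γ(τ(G)) + 1.

open import Defs
open import Data.Nat using (ℕ; _≤_; _+_; ∣_-_∣; z≤n; s≤s)
open import Data.Nat.Properties
  using (≤-trans; ≤-reflexive; +-monoʳ-≤; +-suc; m≤n+o⇒m∸n≤o; ∣m-n∣≡[m∸n]∨[n∸m]; module ≤-Reasoning)
open import Data.Bool using (true; false; _∨_)
open import Data.Bool.Properties using (∨-zeroʳ)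
open import Data.Fin using (Fin)
open import Data.Fin.Properties using (_≟_)
open import Data.Fin.Subset using (Subset; inside; outside; _∈_; _∉_; _⊆_; _∪_; ⁅_⁆; ∣_∣)
open import Data.Fin.Subset.Properties
  using (_∈?_; x∈⁅x⁆; p⊆p∪q; q⊆p∪q; ∣⁅x⁆∣≡1; ∣p∣≤∣x∷p∣)
open import Data.Vec using ([]; _∷_)
open import Data.Product using (∃; _×_; _,_)
open import Data.Sum using (_⊎_; inj₁; inj₂; swap; map)
open import Function using (_∘_)
open import Data.Empty using (⊥-elim)
open import Relation.Binary.PropositionalEquality using (_≡_; refl; trans; subst)
import Relation.Binary.PropositionalEquality as ≡
open import Relation.Nullary using (¬_; Dec; yes; no; proof)
open import Relation.Nullary.Decidable using (_×-dec_; _⊎-dec_; dec-true; dec-false)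
open import Relation.Nullary.Reflects using (Reflects; invert)

∣p∪q∣≤∣p∣+∣q∣ : ∀ {n} (p q : Subset n) → ∣ p ∪ q ∣ ≤ ∣ p ∣ + ∣ q ∣
∣p∪q∣≤∣p∣+∣q∣ []            []            = z≤n
∣p∪q∣≤∣p∣+∣q∣ (inside  ∷ p) (s ∷ q)       =
  s≤s (≤-trans (∣p∪q∣≤∣p∣+∣q∣ p q) (+-monoʳ-≤ ∣ p ∣ (∣p∣≤∣x∷p∣ s q)))
∣p∪q∣≤∣p∣+∣q∣ (outside ∷ p) (inside  ∷ q) =
  ≤-trans (s≤s (∣p∪q∣≤∣p∣+∣q∣ p q)) (≤-reflexive (≡.sym (+-suc ∣ p ∣ ∣ q ∣)))
∣p∪q∣≤∣p∣+∣q∣ (outside ∷ p) (outside ∷ q) = ∣p∪q∣≤∣p∣+∣q∣ p q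

m≤n+o∧n≤m+o⇒∣m-n∣≤o : ∀ m n {o} → m ≤ n + o → n ≤ m + o → ∣ m - n ∣ ≤ o
m≤n+o∧n≤m+o⇒∣m-n∣≤o m n m≤n+o n≤m+o with ∣m-n∣≡[m∸n]∨[n∸m] m n
... | inj₁ eq = ≤-trans (≤-reflexive eq) (m≤n+o⇒m∸n≤o m n m≤n+o)
... | inj₂ eq = ≤-trans (≤-reflexive eq) (m≤n+o⇒m∸n≤o n m n≤m+o)

module _ {n : ℕ} where

  OnPair : (p q x y : Fin n) → Set
  OnPair p q x y = (x ≡ p × y ≡ q) ⊎ (x ≡ q × y ≡ p)

  onPair? : ∀ p q x y → Dec (OnPair p q x y)
  onPair? p q x y = (x ≟ p ×-dec y ≟ q) ⊎-dec (x ≟ q ×-dec y ≟ p)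

  -- samePair x y p q is definitionally does (onPair? p q x y).
  samePair≡true⇒OnPair : ∀ {p q x y} → samePair x y p q ≡ true → OnPair p q x y
  samePair≡true⇒OnPair {p} {q} {x} {y} eq =
    invert (subst (Reflects (OnPair p q x y)) eq (proof (onPair? p q x y)))

  OnPair⇒samePair≡true : ∀ {p q x y} → OnPair p q x y → samePair x y p q ≡ true
  OnPair⇒samePair≡true {p} {q} {x} {y} = dec-true (onPair? p q x y)

  ¬OnPair⇒samePair≡false : ∀ {p q x y} → ¬ OnPair p q x y → samePair x y p q ≡ false
  ¬OnPair⇒samePair≡false {p} {q} {x} {y} = dec-false (onPair? p q x y)

  Meets : Subset n → Fin n → Fin n → Set
  Meets D x y = x ∈ D ⊎ y ∈ D

  Edge-sym : ∀ (G : Graph n) {u v} → Edge G u v → Edge G v u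
  Edge-sym G {u} {v} e = trans (Graph.sym G v u) e

  -- H contains G − pq − rs + pr + qs.
  record Rewiring (G H : Graph n) (p q r s : Fin n) : Set where
    field
      kept : ∀ {u v} → Edge G u v → Edge H u v ⊎ OnPair p q u v ⊎ OnPair r s u v
      pr∈H : Edge H p r
      qs∈H : Edge H q s

  module _ {G H : Graph n} {p q r s : Fin n} (R : Rewiring G H p q r s) where
    open Rewiring R

    dominated-by-partner : ∀ {D x y} → Meets D x y → x ∉ D → Edge H y x →
                           ∃ λ w → w ∈ D × Edge H w x
    dominated-by-partner (inj₁ x∈D) x∉D _  = ⊥-elim (x∉D x∈D)
    dominated-by-partner (inj₂ y∈D) _   yx = _ , y∈D , yx

    Dominating-rewired : ∀ {D D'} → Dominating G D → D ⊆ D' →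
                         (Meets D p r → Meets D' q s) → (Meets D q s → Meets D' p r) →
                         Dominating H D'
    Dominating-rewired {D} {D'} dom D⊆D' pr⇒qs qs⇒pr v v∉D' = repair (dom v (v∉D' ∘ D⊆D'))
      where
      repair : ∃ (λ u → u ∈ D × Edge G u v) → ∃ λ w → w ∈ D' × Edge H w v
      repair (u , u∈D , uv) with kept uv
      ... | inj₁ uv∈H = u , D⊆D' u∈D , uv∈H
      ... | inj₂ (inj₁ (inj₁ (refl , refl))) =
        dominated-by-partner (pr⇒qs (inj₁ u∈D)) v∉D' (Edge-sym H qs∈H)
      ... | inj₂ (inj₁ (inj₂ (refl , refl))) =
        dominated-by-partner (qs⇒pr (inj₁ u∈D)) v∉D' (Edge-sym H pr∈H)
      ... | inj₂ (inj₂ (inj₁ (refl , refl))) =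
        dominated-by-partner (swap (pr⇒qs (inj₂ u∈D))) v∉D' qs∈H
      ... | inj₂ (inj₂ (inj₂ (refl , refl))) =
        dominated-by-partner (swap (qs⇒pr (inj₂ u∈D))) v∉D' pr∈H

    Dominating-rewired-∪⁅⁆ : ∀ {D} → Dominating G D →
                             ∃ λ x → Dominating H (D ∪ ⁅ x ⁆)
    Dominating-rewired-∪⁅⁆ {D} dom with q ∈? D ⊎-dec s ∈? D
    ... | yes qs = p , Dominating-rewired dom (p⊆p∪q _)
                         (λ _ → map (p⊆p∪q _) (p⊆p∪q _) qs)
                         (λ _ → inj₁ (q⊆p∪q D _ (x∈⁅x⁆ p)))
    ... | no ¬qs = q , Dominating-rewired dom (p⊆p∪q _)
                         (λ _ → inj₁ (q⊆p∪q D _ (x∈⁅x⁆ q)))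
                         (⊥-elim ∘ ¬qs)

    domination-number-rewired : ∀ {k l} → IsDominationNumber G k → IsDominationNumber H l →
                                l ≤ k + 1
    domination-number-rewired {k} {l} ((D , dom , ∣D∣≡k) , _) (_ , minimal)
      with Dominating-rewired-∪⁅⁆ dom
    ... | x , dom' = begin
      l                 ≤⟨ minimal (D ∪ ⁅ x ⁆) dom' ⟩
      ∣ D ∪ ⁅ x ⁆ ∣     ≤⟨ ∣p∪q∣≤∣p∣+∣q∣ D ⁅ x ⁆ ⟩
      ∣ D ∣ + ∣ ⁅ x ⁆ ∣ ≡⟨ ≡.cong₂ _+_ ∣D∣≡k (∣⁅x⁆∣≡1 x) ⟩
      k + 1             ∎
      where open ≤-Reasoning

  module _ (G : Graph n) (t : TwoSwitch G) where

    τ-rewiring : Rewiring G (τ G t) (a t) (b t) (c t) (d t)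
    τ-rewiring = record { kept = kept ; pr∈H = ac∈τ ; qs∈H = bd∈τ }
      where
      kept : ∀ {u v} → Edge G u v →
             Edge (τ G t) u v ⊎ OnPair (a t) (b t) u v ⊎ OnPair (c t) (d t) u v
      kept {u} {v} uv with samePair u v (a t) (b t) in ab? | samePair u v (c t) (d t) in cd?
      ... | true  | _    = inj₂ (inj₁ (samePair≡true⇒OnPair ab?))
      ... | false | true = inj₂ (inj₂ (samePair≡true⇒OnPair cd?))
      ... | false | false with samePair u v (a t) (c t) ∨ samePair u v (b t) (d t)
      ...   | true  = inj₁ refl
      ...   | false = inj₁ uv

      ac∉ab : ¬ OnPair (a t) (b t) (a t) (c t)
      ac∉ab (inj₁ (_ , c≡b)) = b≢c t (≡.sym c≡b)
      ac∉ab (inj₂ (a≡b , _)) = a≢b t a≡b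

      ac∉cd : ¬ OnPair (c t) (d t) (a t) (c t)
      ac∉cd (inj₁ (a≡c , _)) = a≢c t a≡c
      ac∉cd (inj₂ (a≡d , _)) = a≢d t a≡d

      bd∉ab : ¬ OnPair (a t) (b t) (b t) (d t)
      bd∉ab (inj₁ (b≡a , _)) = a≢b t (≡.sym b≡a)
      bd∉ab (inj₂ (_ , d≡a)) = a≢d t (≡.sym d≡a)

      bd∉cd : ¬ OnPair (c t) (d t) (b t) (d t)
      bd∉cd (inj₁ (b≡c , _)) = b≢c t b≡c
      bd∉cd (inj₂ (b≡d , _)) = b≢d t b≡d

      ac∈τ : Edge (τ G t) (a t) (c t)
      ac∈τ rewrite ¬OnPair⇒samePair≡false ac∉ab | ¬OnPair⇒samePair≡false ac∉cd
                 | OnPair⇒samePair≡true {a t} {c t} (inj₁ (refl , refl)) = refl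

      bd∈τ : Edge (τ G t) (b t) (d t)
      bd∈τ rewrite ¬OnPair⇒samePair≡false bd∉ab | ¬OnPair⇒samePair≡false bd∉cd
                 | OnPair⇒samePair≡true {b t} {d t} (inj₁ (refl , refl))
                 | ∨-zeroʳ (samePair (b t) (d t) (a t) (c t)) = refl

    τ-rewiring⁻¹ : Rewiring (τ G t) G (a t) (c t) (b t) (d t)
    τ-rewiring⁻¹ = record { kept = kept ; pr∈H = ab∈E t ; qs∈H = cd∈E t }
      where
      kept : ∀ {u v} → Edge (τ G t) u v →
             Edge G u v ⊎ OnPair (a t) (c t) u v ⊎ OnPair (b t) (d t) u v
      kept {u} {v} uv with samePair u v (a t) (b t) | samePair u v (c t) (d t)
      kept () | true  | _
      kept () | false | true
      ... | false | false with samePair u v (a t) (c t) in ac? | samePair u v (b t) (d t) in bd?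
      ...   | true  | _     = inj₂ (inj₁ (samePair≡true⇒OnPair ac?))
      ...   | false | true  = inj₂ (inj₂ (samePair≡true⇒OnPair bd?))
      ...   | false | false = inj₁ uv

mainTheorem13 : ∀ {n : ℕ} (G : Graph n) (t : TwoSwitch G) (γG γτG : ℕ) →
    IsDominationNumber G γG → IsDominationNumber (τ G t) γτG →
    ∣ γτG - γG ∣ ≤ 1
mainTheorem13 G t γG γτG γ[G] γ[τG] = m≤n+o∧n≤m+o⇒∣m-n∣≤o γτG γG
  (domination-number-rewired (τ-rewiring G t) γ[G] γ[τG])
  (domination-number-rewired (τ-rewiring⁻¹ G t) γ[τG] γ[G])
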